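{- Let $S=(s_1,s_2,\ldots)$ be a packing sequence with $s_2\le 2$. If $e$ is a cut-edge of a graph $G$ and $\chi_S(G-e)\ge 2$, then $\chi_S(G-e)\ge(\chi_S(G)+1)/2$.
   Context: All graphs are finite and simple. A packing sequence is an infinite non-decreasing sequence $S=(s_1,s_2,\ldots)$ of positive integers. A map $c:V(G)\to\{1,\ldots,m\}$ is an $S$-packing $m$-coloring of $G$ if for distinct $u,v$, $c(u)=c(v)=i$ implies $d_G(u,v)>s_i$ ($d_G$ shortest-path distance, infinite between components); $\chi_S(G)$ is the least such $m$. A cut-edge is an edge whose removal increases the number of components. -}

module Defs where

open import Data.Nat using (ℕ; zero; suc; _≤_; _<_)
open import Data.Bool using (Bool; true; false; _∧_; not; _∨_)
open import Data.Fin using (Fin; _≟_)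
open import Data.Product using (Σ; _×_; _,_; ∃)
open import Function.Definitions using (Surjective)
open import Relation.Binary.PropositionalEquality using (_≡_; _≢_)
open import Relation.Nullary using (¬_)
open import Relation.Nullary.Decidable using (⌊_⌋)
open import Function.Bundles using (_⇔_)

record Graph : Set where
  field
    n     : ℕ
    adj   : Fin n → Fin n → Bool
    sym   : ∀ u v → adj u v ≡ adj v u
    loopless : ∀ v → adj v v ≡ false
open Graph public

data Walk (G : Graph) : Fin (n G) → Fin (n G) → ℕ → Set where
  here : ∀ {u} → Walk G u u 0
  step : ∀ {u w v k} → adj G u w ≡ true → Walk G w v k → Walk G u v (suc k)

Connected : (G : Graph) → Fin (n G) → Fin (n G) → Set
Connected G u v = ∃ λ k → Walk G u v k

-- d_G(u,v) > s  (true also when u,v lie in different components: d = ∞)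
DistGt : (G : Graph) → Fin (n G) → Fin (n G) → ℕ → Set
DistGt G u v s = ∀ k → k ≤ s → ¬ Walk G u v k

NumComponents : Graph → ℕ → Set
NumComponents G k = Σ (Fin (n G) → Fin k) λ f →
  Surjective _≡_ _≡_ f × (∀ u v → (f u ≡ f v) ⇔ Connected G u v)

-- Packing sequence S = (s_1, s_2, ...), encoded as s : ℕ → ℕ using indices ≥ 1
-- (the value s 0 is irrelevant).
record PackingSeq : Set where
  field
    s        : ℕ → ℕ
    positive : ∀ i → 1 ≤ i → 1 ≤ s i
    mono     : ∀ i j → 1 ≤ i → i ≤ j → s i ≤ s j
open PackingSeq public

IsPackingColoring : PackingSeq → (G : Graph) → ℕ → (Fin (n G) → ℕ) → Set
IsPackingColoring S G m c =
  (∀ v → 1 ≤ c v × c v ≤ m) ×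
  (∀ u v → u ≢ v → c u ≡ c v → DistGt G u v (s S (c u)))

HasPackingColoring : PackingSeq → Graph → ℕ → Set
HasPackingColoring S G m = Σ (Fin (n G) → ℕ) (IsPackingColoring S G m)

ChiS : PackingSeq → Graph → ℕ → Set
ChiS S G m = HasPackingColoring S G m × (∀ m' → HasPackingColoring S G m' → m ≤ m')

deleteEdge : (G : Graph) → Fin (n G) → Fin (n G) → Graph
deleteEdge G x y = record
  { n = n G
  ; adj = λ u v → adj G u v ∧ not (isxy u v)
  ; sym = symProof
  ; loopless = λ v → loopProof v
  }
  where
  open import Relation.Binary.PropositionalEquality using (cong₂; refl)
  isxy : Fin (n G) → Fin (n G) → Bool
  isxy u v = (⌊ u ≟ x ⌋ ∧ ⌊ v ≟ y ⌋) ∨ (⌊ u ≟ y ⌋ ∧ ⌊ v ≟ x ⌋)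
  ∧-comm' : ∀ a b → (a ∧ b) ≡ (b ∧ a)
  ∧-comm' false false = refl
  ∧-comm' false true = refl
  ∧-comm' true false = refl
  ∧-comm' true true = refl
  ∨-comm' : ∀ a b → (a ∨ b) ≡ (b ∨ a)
  ∨-comm' false false = refl
  ∨-comm' false true = refl
  ∨-comm' true false = refl
  ∨-comm' true true = refl
  isxy-sym : ∀ u v → isxy u v ≡ isxy v u
  isxy-sym u v with ⌊ u ≟ x ⌋ | ⌊ v ≟ y ⌋ | ⌊ u ≟ y ⌋ | ⌊ v ≟ x ⌋
  ... | a | b | c | d = Relation.Binary.PropositionalEquality.trans
        (cong₂ _∨_ (∧-comm' a b) (∧-comm' c d)) (∨-comm' (b ∧ a) (d ∧ c))
  symProof : ∀ u v → (adj G u v ∧ not (isxy u v)) ≡ (adj G v u ∧ not (isxy v u))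
  symProof u v = cong₂ (λ a b → a ∧ not b) (sym G u v) (isxy-sym u v)
  loopProof : ∀ v → (adj G v v ∧ not (isxy v v)) ≡ false
  loopProof v with adj G v v | loopless G v
  ... | .false | refl = refl

IsCutEdge : (G : Graph) → Fin (n G) → Fin (n G) → Set
IsCutEdge G x y = adj G x y ≡ true ×
  (∀ k k' → NumComponents G k → NumComponents (deleteEdge G x y) k' → k < k')

module Submission where

-- Let c be an optimal packing colouring of G - xy; x and y lie in different
-- components of G - xy, so two vertices of colour i within distance s_i in G
-- are joined through the edge xy. For a colour i ≥ 3, the vertex of colour i nearest
-- to {x, y} belongs to every such conflict, and it gets a colour of its own.
-- For colours 1 and 2 a conflict has length at most 2, so it consists of an end of
-- the edge and a vertex at distance ≤ 1 from the other end; after exchanging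
-- colours 1 and 2 on the side of y when s₁ = s₂, one end of the edge meets all of
-- them. This recolours at most a - 1 vertices, each with a new colour.

open import Data.Bool using (true; false; if_then_else_)
open import Data.Empty using (⊥; ⊥-elim)
open import Data.Fin using (Fin; zero; suc; _≟_)
open import Data.Fin.Properties using (any?; suc-injective; <⇒notInjective)
open import Data.Nat using (ℕ; zero; suc; _+_; _*_; _∸_; _≤_; _<_; z≤n; s≤s; _≤?_)
open import Data.Nat.Induction using (<-rec)
import Data.Nat.Properties as ℕ
open import Data.Product using (Σ; ∃; ∃-syntax; _×_; _,_; proj₁; proj₂)
import Data.Product as Product
open import Data.Sum using (_⊎_; inj₁; inj₂)
import Data.Sum as Sum
open import Function.Base using (case_of_)
open import Function.Bundles using (_⇔_; mk⇔; Equivalence)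
open import Function.Definitions using (Surjective)
open import Relation.Binary.Definitions using (Decidable)
open import Relation.Binary.PropositionalEquality
  using (_≡_; _≢_; refl; trans; cong; subst) renaming (sym to ≡-sym)
open import Relation.Binary.Structures using (IsEquivalence; IsDecEquivalence)
open import Relation.Nullary using (¬_; Dec; yes; no; does)
open import Relation.Nullary.Decidable
  using (map′; _×-dec_; _⊎-dec_; _→-dec_; dec-true; dec-false; decidable-stable; ¬¬-excluded-middle)

open import Defs hiding (sym)

least : ∀ {P : ℕ → Set} → (∀ m → Dec (P m)) → ∀ {m} → P m → ∃[ p ] P p × (∀ {k} → P k → p ≤ k)
least {P} P? {m} = <-rec (λ m → P m → ∃[ p ] P p × (∀ {k} → P k → p ≤ k)) search m
  where
  search : ∀ m → (∀ {k} → k < m → P k → ∃[ p ] P p × (∀ {k} → P k → p ≤ k)) →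
           P m → ∃[ p ] P p × (∀ {k} → P k → p ≤ k)
  search m smaller Pm with ℕ.anyUpTo? P? m
  ... | yes (k , k<m , Pk) = smaller k<m Pk
  ... | no none            = m , Pm , λ {k} Pk → ℕ.≮⇒≥ λ k<m → none (k , k<m , Pk)

¬¬-∀-Fin : ∀ {n} {P : Fin n → Set} → (∀ i → ¬ ¬ P i) → ¬ ¬ (∀ i → P i)
¬¬-∀-Fin {zero}  _   ¬all = ¬all λ ()
¬¬-∀-Fin {suc n} ¬¬P ¬all = ¬¬P zero λ P0 → ¬¬-∀-Fin (λ i → ¬¬P (suc i)) λ Psuc →
  ¬all λ { zero → P0 ; (suc i) → Psuc i }

_++ʷ_ : ∀ {G u w v k m} → Walk G u w k → Walk G w v m → Walk G u v (k + m)
here     ++ʷ q = q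
step e p ++ʷ q = step e (p ++ʷ q)

reverseʷ : ∀ {G u v k} → Walk G u v k → Walk G v u k
reverseʷ                     here                  = here
reverseʷ {G} {k = suc k} (step {u} {w} e p) =
  subst (Walk G _ u) (ℕ.+-comm k 1) (reverseʷ p ++ʷ step (trans (Graph.sym G w u) e) here)

walk? : (G : Graph) → ∀ u v k → Dec (Walk G u v k)
walk? G u v zero with u ≟ v
... | yes refl = yes here
... | no u≢v   = no λ { here → u≢v refl }
walk? G u v (suc k) with any? firstStep?
  where
  firstStep? : ∀ w → Dec (adj G u w ≡ true × Walk G w v k)
  firstStep? w with adj G u w | walk? G w v k
  ... | true  | yes p = yes (refl , p)
  ... | true  | no ¬p = no λ q → ¬p (proj₂ q)
  ... | false | _     = no λ ()
... | yes (_ , e , p) = yes (step e p)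
... | no ¬step        = no λ { (step e p) → ¬step (_ , e , p) }

Connected-isEquivalence : (G : Graph) → IsEquivalence (Connected G)
Connected-isEquivalence G = record
  { refl  = 0 , here
  ; sym   = λ (k , p) → k , reverseʷ p
  ; trans = λ (k , p) (m , q) → k + m , p ++ʷ q
  }

Quotient : ∀ {n} → (Fin n → Fin n → Set) → Set
Quotient {n} R = ∃[ k ] Σ (Fin n → Fin k) λ f →
  Surjective _≡_ _≡_ f × (∀ u v → (f u ≡ f v) ⇔ R u v)

quotient : ∀ {n} {R : Fin n → Fin n → Set} → IsDecEquivalence R → Quotient R
quotient {zero} _ = 0 , (λ ()) , (λ ()) , λ ()
quotient {suc n} {R} isDecEq with quotient isDecEqOnSuc | any? (λ u → zero ≟ᴿ suc u)
  where
  open IsDecEquivalence isDecEq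
    using () renaming (refl to reflᴿ; sym to symᴿ; trans to transᴿ; _≟_ to _≟ᴿ_)
  isDecEqOnSuc : IsDecEquivalence (λ u v → R (suc u) (suc v))
  isDecEqOnSuc = record
    { isEquivalence = record { refl = reflᴿ ; sym = symᴿ ; trans = transᴿ }
    ; _≟_ = λ u v → suc u ≟ᴿ suc v
    }
... | k , f , f-surj , f-classes | yes (u₀ , R0u₀) = k , g , g-surj , g-classes
  where
  open IsDecEquivalence isDecEq
    using () renaming (refl to reflᴿ; sym to symᴿ; trans to transᴿ)
  g : Fin (suc n) → Fin k
  g zero    = f u₀
  g (suc u) = f u
  g-surj : Surjective _≡_ _≡_ g
  g-surj j = let (u , fu≡j) = f-surj j in suc u , λ { refl → fu≡j refl }
  g-classes : ∀ u v → (g u ≡ g v) ⇔ R u v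
  g-classes zero    zero    = mk⇔ (λ _ → reflᴿ) (λ _ → refl)
  g-classes zero    (suc v) = mk⇔ (λ e → transᴿ R0u₀ (Equivalence.to (f-classes u₀ v) e))
                                  (λ r → Equivalence.from (f-classes u₀ v) (transᴿ (symᴿ R0u₀) r))
  g-classes (suc u) zero    = mk⇔ (λ e → transᴿ (Equivalence.to (f-classes u u₀) e) (symᴿ R0u₀))
                                  (λ r → Equivalence.from (f-classes u u₀) (transᴿ r R0u₀))
  g-classes (suc u) (suc v) = f-classes u v
... | k , f , f-surj , f-classes | no ¬R0 = suc k , g , g-surj , g-classes
  where
  open IsDecEquivalence isDecEq
    using () renaming (refl to reflᴿ; sym to symᴿ)
  g : Fin (suc n) → Fin (suc k)
  g zero    = zero
  g (suc u) = suc (f u)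
  g-surj : Surjective _≡_ _≡_ g
  g-surj zero    = zero , λ { refl → refl }
  g-surj (suc j) = let (u , fu≡j) = f-surj j in suc u , λ { refl → cong suc (fu≡j refl) }
  g-classes : ∀ u v → (g u ≡ g v) ⇔ R u v
  g-classes zero    zero    = mk⇔ (λ _ → reflᴿ) (λ _ → refl)
  g-classes zero    (suc v) = mk⇔ (λ ()) (λ r → ⊥-elim (¬R0 (v , r)))
  g-classes (suc u) zero    = mk⇔ (λ ()) (λ r → ⊥-elim (¬R0 (u , symᴿ r)))
  g-classes (suc u) (suc v) = mk⇔ (λ e → Equivalence.to (f-classes u v) (suc-injective e))
                                  (λ r → cong suc (Equivalence.from (f-classes u v) r))

numComponents : (G : Graph) → Decidable (Connected G) → ∃ (NumComponents G)
numComponents G connected? = quotient record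
  { isEquivalence = Connected-isEquivalence G ; _≟_ = connected? }

¬¬-decidableConnected : (G : Graph) → ¬ ¬ Decidable (Connected G)
¬¬-decidableConnected G = ¬¬-∀-Fin λ u → ¬¬-∀-Fin λ v → ¬¬-excluded-middle

module EdgeDeletion (G : Graph) (x y : Fin (n G)) where

  G⁻ : Graph
  G⁻ = deleteEdge G x y

  open IsEquivalence (Connected-isEquivalence G⁻) using () renaming (sym to ⇝⁻-sym; trans to ⇝⁻-trans)

  deletedEdge : ∀ u v → adj G u v ≡ true → adj G⁻ u v ≡ false → (u ≡ x × v ≡ y) ⊎ (u ≡ y × v ≡ x)
  deletedEdge u v e e⁻ with adj G u v | u ≟ x | v ≟ y | u ≟ y | v ≟ x
  ... | true | yes u≡x | yes v≡y | _       | _       = inj₁ (u≡x , v≡y)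
  ... | true | _       | _       | yes u≡y | yes v≡x = inj₂ (u≡y , v≡x)
  ... | true | yes _   | no _    | yes _   | no _    = case e⁻ of λ ()
  ... | true | yes _   | no _    | no _    | _       = case e⁻ of λ ()
  ... | true | no _    | _       | yes _   | no _    = case e⁻ of λ ()
  ... | true | no _    | _       | no _    | _       = case e⁻ of λ ()

  ShortWalk⁻ : Fin (n G) → Fin (n G) → ℕ → Set
  ShortWalk⁻ u v k = ∃[ k' ] k' ≤ k × Walk G⁻ u v k'

  Crossing : Fin (n G) → Fin (n G) → Fin (n G) → Fin (n G) → ℕ → Set
  Crossing p q u v k = ∃[ k₁ ] ∃[ k₂ ] Walk G⁻ u p k₁ × Walk G⁻ q v k₂ × suc (k₁ + k₂) ≤ k

  -- Splitting a walk whose first step is the deleted edge p q, given a split of the rest.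
  crossFirst : ∀ {p q v k} → ShortWalk⁻ q v k ⊎ Crossing p q q v k ⊎ Crossing q p q v k →
               ShortWalk⁻ p v (suc k) ⊎ Crossing p q p v (suc k)
  crossFirst (inj₁ (k' , k'≤k , w)) = inj₂ (0 , k' , here , w , s≤s k'≤k)
  crossFirst (inj₂ (inj₁ (k₁ , k₂ , _ , w , l))) = inj₂ (0 , k₂ , here , w , s≤s (ℕ.m+n≤o⇒n≤o (suc k₁) l))
  crossFirst (inj₂ (inj₂ (k₁ , k₂ , _ , w , l))) = inj₁ (k₂ , ℕ.m≤n⇒m≤1+n (ℕ.m+n≤o⇒n≤o (suc k₁) l) , w)

  walk-split : ∀ {u v k} → Walk G u v k → ShortWalk⁻ u v k ⊎ Crossing x y u v k ⊎ Crossing y x u v k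
  walk-split here = inj₁ (0 , z≤n , here)
  walk-split (step {u} {w} e p) with adj G⁻ u w in e⁻ | walk-split p
  ... | true | inj₁ (k' , k'≤k , q) = inj₁ (suc k' , s≤s k'≤k , step e⁻ q)
  ... | true | inj₂ (inj₁ (k₁ , k₂ , q₁ , q₂ , l)) = inj₂ (inj₁ (suc k₁ , k₂ , step e⁻ q₁ , q₂ , s≤s l))
  ... | true | inj₂ (inj₂ (k₁ , k₂ , q₁ , q₂ , l)) = inj₂ (inj₂ (suc k₁ , k₂ , step e⁻ q₁ , q₂ , s≤s l))
  ... | false | rest with deletedEdge u w e e⁻
  ...   | inj₁ (refl , refl) = Sum.map₂ inj₁ (crossFirst rest)
  ...   | inj₂ (refl , refl) = Sum.map₂ inj₂ (crossFirst (Sum.map₂ Sum.swap rest))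

  connected⇒connected⁻ : Connected G⁻ x y → ∀ {u v} → Connected G u v → Connected G⁻ u v
  connected⇒connected⁻ xy (_ , w) with walk-split w
  ... | inj₁ (k , _ , q) = k , q
  ... | inj₂ (inj₁ (k₁ , k₂ , q₁ , q₂ , _)) = ⇝⁻-trans (k₁ , q₁) (⇝⁻-trans xy (k₂ , q₂))
  ... | inj₂ (inj₂ (k₁ , k₂ , q₁ , q₂ , _)) = ⇝⁻-trans (k₁ , q₁) (⇝⁻-trans (⇝⁻-sym xy) (k₂ , q₂))

  -- If x and y stay connected, both graphs have the same components, so the
  -- components of G⁻ inject into those of G.
  cutEdge⇒disconnected : Decidable (Connected G) → Decidable (Connected G⁻) →
                         IsCutEdge G x y → ¬ Connected G⁻ x y
  cutEdge⇒disconnected connected? connected⁻? (_ , moreComponents) xy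
    with numComponents G connected? | numComponents G⁻ connected⁻?
  ... | k , components@(f , _ , f-classes) | k⁻ , components⁻@(f⁻ , f⁻-surj , f⁻-classes) =
    <⇒notInjective (moreComponents k k⁻ components components⁻) g-injective
    where
    pick : Fin k⁻ → Fin (n G)
    pick j = proj₁ (f⁻-surj j)
    g : Fin k⁻ → Fin k
    g j = f (pick j)
    g-injective : ∀ {i j} → g i ≡ g j → i ≡ j
    g-injective {i} {j} gi≡gj = trans (≡-sym (proj₂ (f⁻-surj i) refl)) (trans
      (Equivalence.from (f⁻-classes (pick i) (pick j))
        (connected⇒connected⁻ xy (Equivalence.to (f-classes (pick i) (pick j)) gi≡gj)))
      (proj₂ (f⁻-surj j) refl))

swap₁₂ : ℕ → ℕ
swap₁₂ 1 = 2
swap₁₂ 2 = 1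
swap₁₂ i = i

swap₁₂-involutive : ∀ i → swap₁₂ (swap₁₂ i) ≡ i
swap₁₂-involutive 0                   = refl
swap₁₂-involutive 1                   = refl
swap₁₂-involutive 2                   = refl
swap₁₂-involutive (suc (suc (suc i))) = refl

swap₁₂-injective : ∀ {i j} → swap₁₂ i ≡ swap₁₂ j → i ≡ j
swap₁₂-injective {i} {j} e =
  trans (≡-sym (swap₁₂-involutive i)) (trans (cong swap₁₂ e) (swap₁₂-involutive j))

swap₁₂-bounded : ∀ {m i} → 2 ≤ m → 1 ≤ i → i ≤ m → 1 ≤ swap₁₂ i × swap₁₂ i ≤ m
swap₁₂-bounded {i = 1}                   2≤m _   _   = s≤s z≤n , 2≤m
swap₁₂-bounded {i = 2}                   2≤m _   _   = s≤s z≤n , ℕ.≤-trans (s≤s z≤n) 2≤m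
swap₁₂-bounded {i = suc (suc (suc _))}   _   1≤i i≤m = 1≤i , i≤m

swap₁₂-aligns : ∀ {i j} → 1 ≤ i → i ≤ 2 → 1 ≤ j → swap₁₂ j ≤ 2 → i ≢ j → i ≡ swap₁₂ j
swap₁₂-aligns {1} {1} _ _ _ _ i≢j = ⊥-elim (i≢j refl)
swap₁₂-aligns {1} {2} _ _ _ _ _   = refl
swap₁₂-aligns {2} {1} _ _ _ _ _   = refl
swap₁₂-aligns {2} {2} _ _ _ _ i≢j = ⊥-elim (i≢j refl)
swap₁₂-aligns {suc (suc (suc _))} _ (s≤s (s≤s ())) _ _ _
swap₁₂-aligns {1} {suc (suc (suc _))} _ _ _ (s≤s (s≤s ())) _
swap₁₂-aligns {2} {suc (suc (suc _))} _ _ _ (s≤s (s≤s ())) _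

lowColours-differ : ∀ {i j} → 1 ≤ i → i ≤ 2 → 1 ≤ j → j ≤ 2 → i ≢ j → j ≢ 1 → i ≡ 1 × j ≡ 2
lowColours-differ {1} {1} _ _ _ _ i≢j _   = ⊥-elim (i≢j refl)
lowColours-differ {1} {2} _ _ _ _ _   _   = refl , refl
lowColours-differ {2} {1} _ _ _ _ _   j≢1 = ⊥-elim (j≢1 refl)
lowColours-differ {2} {2} _ _ _ _ i≢j _   = ⊥-elim (i≢j refl)
lowColours-differ {suc (suc (suc _))} _ (s≤s (s≤s ())) _ _ _ _
lowColours-differ {1} {suc (suc (suc _))} _ _ _ (s≤s (s≤s ())) _ _
lowColours-differ {2} {suc (suc (suc _))} _ _ _ (s≤s (s≤s ())) _ _

-- Colours 1 and 2 share a new colour: as s₂ ≤ 2, one vertex meets all their conflicts.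
freshIndex : ℕ → ℕ
freshIndex (suc (suc (suc i))) = suc (suc i)
freshIndex _                   = 1

freshIndex-bounded : ∀ {m i} → 2 ≤ m → i ≤ m → 1 ≤ freshIndex i × freshIndex i ≤ m ∸ 1
freshIndex-bounded {i = 0}                 (s≤s 1≤m) _   = s≤s z≤n , 1≤m
freshIndex-bounded {i = 1}                 (s≤s 1≤m) _   = s≤s z≤n , 1≤m
freshIndex-bounded {i = 2}                 (s≤s 1≤m) _   = s≤s z≤n , 1≤m
freshIndex-bounded {i = suc (suc (suc i))} _         i≤m = s≤s z≤n , ℕ.∸-monoˡ-≤ 1 i≤m

module _ (S : PackingSeq) where

  s₁≡s₂ : s S 2 ≤ 2 → 2 ≤ s S 1 → s S 1 ≡ s S 2
  s₁≡s₂ s₂≤2 2≤s₁ = ℕ.≤-antisym (mono S 1 2 (s≤s z≤n) (s≤s z≤n)) (ℕ.≤-trans s₂≤2 2≤s₁)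

  s-low≤2 : s S 2 ≤ 2 → ∀ {i} → 1 ≤ i → i ≤ 2 → s S i ≤ 2
  s-low≤2 s₂≤2 1≤i i≤2 = ℕ.≤-trans (mono S _ 2 1≤i i≤2) s₂≤2

  s∘swap₁₂ : s S 1 ≡ s S 2 → ∀ i → s S (swap₁₂ i) ≡ s S i
  s∘swap₁₂ s₁≡s₂ 0                   = refl
  s∘swap₁₂ s₁≡s₂ 1                   = ≡-sym s₁≡s₂
  s∘swap₁₂ s₁≡s₂ 2                   = s₁≡s₂
  s∘swap₁₂ s₁≡s₂ (suc (suc (suc i))) = refl

  adjacent⇒colours-differ : ∀ {H m c} → IsPackingColoring S H m c →
                            ∀ {u v} → adj H u v ≡ true → c u ≢ c v
  adjacent⇒colours-differ {H} {c = c} (bounded , far) {u} {v} e cu≡cv =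
    far u v u≢v cu≡cv 1 (positive S (c u) (proj₁ (bounded u))) (step e here)
    where
    u≢v : u ≢ v
    u≢v refl = case trans (≡-sym e) (loopless H u) of λ ()

  recolourOn : ∀ {V : Set} {P : V → Set} → (∀ v → Dec (P v)) → (ℕ → ℕ) → (V → ℕ) → V → ℕ
  recolourOn P? π c v = if does (P? v) then π (c v) else c v

  recolourOn-inside : ∀ {V : Set} {P : V → Set} (P? : ∀ v → Dec (P v)) π c {v} →
                      P v → recolourOn P? π c v ≡ π (c v)
  recolourOn-inside P? π c {v} Pv = cong (λ b → if b then π (c v) else c v) (dec-true (P? v) Pv)

  recolourOn-outside : ∀ {V : Set} {P : V → Set} (P? : ∀ v → Dec (P v)) π c {v} →
                       ¬ P v → recolourOn P? π c v ≡ c v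
  recolourOn-outside P? π c {v} ¬Pv = cong (λ b → if b then π (c v) else c v) (dec-false (P? v) ¬Pv)

  recolourComponent : ∀ {H m c} → IsPackingColoring S H m c →
    (π : ℕ → ℕ) → (∀ {i j} → π i ≡ π j → i ≡ j) → (∀ {i} → 1 ≤ i → i ≤ m → 1 ≤ π i × π i ≤ m) →
    (∀ i → s S (π i) ≡ s S i) → (z : Fin (n H)) (connected? : ∀ v → Dec (Connected H z v)) →
    IsPackingColoring S H m (recolourOn connected? π c)
  recolourComponent {H} {m} {c} (bounded , far) π π-injective π-bounded s∘π z connected? =
    bounded′ , far′
    where
    open IsEquivalence (Connected-isEquivalence H) using () renaming (trans to ⇝-trans)
    bounded′ : ∀ v → 1 ≤ recolourOn connected? π c v × recolourOn connected? π c v ≤ m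
    bounded′ v with connected? v
    ... | yes _ = π-bounded (proj₁ (bounded v)) (proj₂ (bounded v))
    ... | no _  = bounded v
    far′ : ∀ u v → u ≢ v → recolourOn connected? π c u ≡ recolourOn connected? π c v →
           DistGt H u v (s S (recolourOn connected? π c u))
    far′ u v u≢v same with connected? u | connected? v
    ... | yes _  | yes _  = subst (DistGt H u v) (≡-sym (s∘π (c u))) (far u v u≢v (π-injective same))
    ... | yes zu | no ¬zv = λ k _ w → ¬zv (⇝-trans zu (k , w))
    ... | no ¬zu | yes zv = λ k _ w → ¬zu (⇝-trans zv (k , reverseʷ w))
    ... | no _   | no _   = far u v u≢v same

  freshRecolouring : ∀ {H : Graph} {m l} (c : Fin (n H) → ℕ) → (∀ v → 1 ≤ c v × c v ≤ m) →
    (κ : Fin (n H) → ℕ) → (∀ v → 1 ≤ κ v × κ v ≤ l) →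
    {R : Fin (n H) → Set} → (∀ v → Dec (R v)) → (∀ {u v} → R u → R v → κ u ≡ κ v → u ≡ v) →
    (∀ {u v} → u ≢ v → c u ≡ c v → ¬ R u → ¬ R v → DistGt H u v (s S (c u))) →
    HasPackingColoring S H (m + l)
  freshRecolouring {H} {m} {l} c c-bounded κ κ-bounded {R} R? R-injective covered =
    c′ , bounded′ , far′
    where
    c′ : Fin (n H) → ℕ
    c′ v = if does (R? v) then m + κ v else c v
    fresh>m : ∀ u v → m + κ u ≢ c v
    fresh>m u v e = ℕ.<⇒≱ (ℕ.m<m+n m (proj₁ (κ-bounded u))) (subst (_≤ m) (≡-sym e) (proj₂ (c-bounded v)))
    bounded′ : ∀ v → 1 ≤ c′ v × c′ v ≤ m + l
    bounded′ v with R? v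
    ... | yes _ = ℕ.≤-trans (proj₁ (κ-bounded v)) (ℕ.m≤n+m (κ v) m) , ℕ.+-monoʳ-≤ m (proj₂ (κ-bounded v))
    ... | no _  = proj₁ (c-bounded v) , ℕ.≤-trans (proj₂ (c-bounded v)) (ℕ.m≤m+n m l)
    far′ : ∀ u v → u ≢ v → c′ u ≡ c′ v → DistGt H u v (s S (c′ u))
    far′ u v u≢v same with R? u | R? v
    ... | yes Ru  | yes Rv  = ⊥-elim (u≢v (R-injective Ru Rv (ℕ.+-cancelˡ-≡ m _ _ same)))
    ... | yes _   | no _    = ⊥-elim (fresh>m u v same)
    ... | no _    | yes _   = ⊥-elim (fresh>m v u (≡-sym same))
    ... | no ¬Ru  | no ¬Rv  = covered u≢v same ¬Ru ¬Rv

module Construction (S : PackingSeq) (s₂≤2 : s S 2 ≤ 2) (G : Graph) (x y : Fin (n G)) where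
  open EdgeDeletion G x y

  LowAligned : (Fin (n G) → ℕ) → Set
  LowAligned c = s S 1 ≡ s S 2 → c x ≤ 2 → c y ≤ 2 → c x ≡ c y

  -- When s₁ = s₂ the colours 1 and 2 may be exchanged on the side of y alone.
  alignLow : ∀ {a c} → 2 ≤ a → ¬ Connected G⁻ x y → Decidable (Connected G⁻) →
             IsPackingColoring S G⁻ a c → ∃[ c′ ] IsPackingColoring S G⁻ a c′ × LowAligned c′
  alignLow {a} {c} 2≤a disconnected connected? valid with s S 1 ℕ.≟ s S 2 | c x ℕ.≟ c y
  ... | no s₁≢s₂ | _        = c , valid , λ s₁≡s₂ → ⊥-elim (s₁≢s₂ s₁≡s₂)
  ... | yes _    | yes cx≡cy = c , valid , λ _ _ _ → cx≡cy
  ... | yes s₁≡s₂ | no cx≢cy = c′ , valid′ , aligned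
    where
    c′ : Fin (n G) → ℕ
    c′ = recolourOn S (connected? y) swap₁₂ c
    valid′ : IsPackingColoring S G⁻ a c′
    valid′ = recolourComponent S valid swap₁₂ swap₁₂-injective (swap₁₂-bounded 2≤a)
               (s∘swap₁₂ S s₁≡s₂) y (connected? y)
    c′x≡cx : c′ x ≡ c x
    c′x≡cx = recolourOn-outside S (connected? y) swap₁₂ c λ (k , w) → disconnected (k , reverseʷ w)
    c′y≡swap : c′ y ≡ swap₁₂ (c y)
    c′y≡swap = recolourOn-inside S (connected? y) swap₁₂ c (0 , here)
    aligned : LowAligned c′
    aligned _ c′x≤2 c′y≤2 = trans c′x≡cx (trans
      (swap₁₂-aligns (proj₁ (proj₁ valid x)) (subst (_≤ 2) c′x≡cx c′x≤2) (proj₁ (proj₁ valid y))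
                     (subst (_≤ 2) c′y≡swap c′y≤2) cx≢cy)
      (≡-sym c′y≡swap))

  module Recolouring {a c} (connected? : Decidable (Connected G⁻))
                     (valid : IsPackingColoring S G⁻ a c) (aligned : LowAligned c) where

    bounded : ∀ v → 1 ≤ c v × c v ≤ a
    bounded = proj₁ valid

    far : ∀ u v → u ≢ v → c u ≡ c v → DistGt G⁻ u v (s S (c u))
    far = proj₂ valid

    sameColour-close⇒≡ : ∀ {i u w k} → c u ≡ i → c w ≡ i → Walk G⁻ u w k → k ≤ s S i → u ≡ w
    sameColour-close⇒≡ {u = u} {w} {k} cu cw walk k≤ with u ≟ w
    ... | yes u≡w = u≡w
    ... | no u≢w  = ⊥-elim (far u w u≢w (trans cu (≡-sym cw)) k (subst (λ j → k ≤ s S j) (≡-sym cu) k≤) walk)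

    Reaches : Fin (n G) → ℕ → Set
    Reaches w m = Walk G⁻ w x m ⊎ Walk G⁻ w y m

    IsNearest : ℕ → Fin (n G) → Set
    IsNearest i r = c r ≡ i × ∃[ p ] Reaches r p × (∀ {w m} → c w ≡ i → Reaches w m → p ≤ m)

    ReachedBy : ℕ → Set
    ReachedBy i = ∃[ w ] ∃[ m ] c w ≡ i × Reaches w m

    reachedBy? : ∀ i → Dec (ReachedBy i)
    reachedBy? i = map′ to from (any? λ w → c w ℕ.≟ i ×-dec (connected? w x ⊎-dec connected? w y))
      where
      to : (∃ λ w → c w ≡ i × (Connected G⁻ w x ⊎ Connected G⁻ w y)) → ReachedBy i
      to (w , cw , inj₁ (m , p)) = w , m , cw , inj₁ p
      to (w , cw , inj₂ (m , p)) = w , m , cw , inj₂ p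
      from : ReachedBy i → ∃ λ w → c w ≡ i × (Connected G⁻ w x ⊎ Connected G⁻ w y)
      from (w , m , cw , inj₁ p) = w , cw , inj₁ (m , p)
      from (w , m , cw , inj₂ p) = w , cw , inj₂ (m , p)

    nearest : ∀ {i} → ReachedBy i → ∃ (IsNearest i)
    nearest {i} (_ , _ , cw , reach) with least reachedAt? (_ , cw , reach)
      where
      reachedAt? : ∀ p → Dec (∃ λ w → c w ≡ i × Reaches w p)
      reachedAt? p = any? λ w → c w ℕ.≟ i ×-dec (walk? G⁻ w x p ⊎-dec walk? G⁻ w y p)
    ... | p , (r , cr , reach) , minimal = r , cr , p , reach , λ cw reach′ → minimal (_ , cw , reach′)

    nearestVertex : ℕ → Fin (n G)
    nearestVertex i with reachedBy? i
    ... | yes reached = proj₁ (nearest reached)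
    ... | no _        = x

    nearestVertex-isNearest : ∀ {i w m} → c w ≡ i → Reaches w m → IsNearest i (nearestVertex i)
    nearestVertex-isNearest {i} cw reach with reachedBy? i
    ... | yes reached = proj₂ (nearest reached)
    ... | no none     = ⊥-elim (none (_ , _ , cw , reach))

    -- If this holds, every conflict in colours 1 and 2 contains y; otherwise each contains x.
    YNeeded : Set
    YNeeded = c x ≤ 2 → c x ≡ 1 × c y ≡ 2

    yNeeded? : Dec YNeeded
    yNeeded? = (c x ≤? 2) →-dec (c x ℕ.≟ 1 ×-dec c y ℕ.≟ 2)

    lowRepresentative : Fin (n G)
    lowRepresentative = if does yNeeded? then y else x

    lowRepresentative≡x : ¬ YNeeded → lowRepresentative ≡ x
    lowRepresentative≡x ¬needed = cong (λ b → if b then y else x) (dec-false yNeeded? ¬needed)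

    lowRepresentative≡y : YNeeded → lowRepresentative ≡ y
    lowRepresentative≡y needed = cong (λ b → if b then y else x) (dec-true yNeeded? needed)

    tooLong : ∀ {i u k} → i ≤ 2 → c u ≡ i → 3 + k ≤ s S i → ⊥
    tooLong i≤2 cu≡i l with ℕ.≤-trans l (s-low≤2 S s₂≤2 (subst (1 ≤_) cu≡i (proj₁ (bounded _))) i≤2)
    ... | s≤s (s≤s ())

    -- As s_i ≤ 2, a crossing conflict in colour i has k₁ + k₂ ≤ 1.
    lowCrossing : ∀ {i u v k₁ k₂} → i ≤ 2 → c u ≡ i → c v ≡ i → Walk G⁻ u x k₁ → Walk G⁻ y v k₂ →
                  suc (k₁ + k₂) ≤ s S i → u ≡ lowRepresentative ⊎ v ≡ lowRepresentative
    lowCrossing i≤2 cx≡i cy≡i here here _ = inj₁ (≡-sym (lowRepresentative≡x ¬needed))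
      where
      ¬needed : ¬ YNeeded
      ¬needed needed with needed (subst (_≤ 2) (≡-sym cx≡i) i≤2)
      ... | cx≡1 , cy≡2 = case trans (≡-sym cx≡1) (trans cx≡i (trans (≡-sym cy≡i) cy≡2)) of λ ()
    lowCrossing i≤2 cx≡i _ here (step _ here) 2≤sᵢ = inj₁ (≡-sym (lowRepresentative≡x ¬needed))
      where
      ¬needed : ¬ YNeeded
      ¬needed needed with needed (subst (_≤ 2) (≡-sym cx≡i) i≤2)
      ... | cx≡1 , cy≡2 = case trans (≡-sym cx≡1) (trans cx≡cy cy≡2) of λ ()
        where
        cx≡cy : c x ≡ c y
        cx≡cy = aligned (s₁≡s₂ S s₂≤2 (subst (λ j → 2 ≤ s S j) (trans (≡-sym cx≡i) cx≡1) 2≤sᵢ))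
                        (subst (_≤ 2) (≡-sym cx≡i) i≤2) (subst (_≤ 2) (≡-sym cy≡2) (s≤s (s≤s z≤n)))
    lowCrossing {i} i≤2 cu≡i cy≡i (step u~x here) here 2≤sᵢ = inj₂ (≡-sym (lowRepresentative≡y needed))
      where
      cx≢cy : c x ≢ c y
      cx≢cy cx≡cy = adjacent⇒colours-differ S valid u~x (trans cu≡i (trans (≡-sym cy≡i) (≡-sym cx≡cy)))
      needed : YNeeded
      needed cx≤2 = Product.map₂ (trans cy≡i)
        (lowColours-differ (proj₁ (bounded x)) cx≤2 (subst (1 ≤_) cy≡i (proj₁ (bounded y))) i≤2
                           (λ cx≡i → cx≢cy (trans cx≡i (≡-sym cy≡i))) i≢1)
        where
        i≢1 : i ≢ 1
        i≢1 i≡1 = cx≢cy (aligned (s₁≡s₂ S s₂≤2 (subst (λ j → 2 ≤ s S j) i≡1 2≤sᵢ)) cx≤2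
                                 (subst (_≤ 2) (≡-sym cy≡i) i≤2))
    lowCrossing i≤2 cu≡i _ here (step _ (step _ _)) l = ⊥-elim (tooLong i≤2 cu≡i l)
    lowCrossing i≤2 cu≡i _ (step _ here) (step _ _) l = ⊥-elim (tooLong i≤2 cu≡i l)
    lowCrossing i≤2 cu≡i _ (step _ (step _ _)) _    l = ⊥-elim (tooLong i≤2 cu≡i l)

    -- The vertex of colour i nearest to {x, y} is no farther from the edge than either
    -- end of a crossing conflict, hence within s_i of one of them, hence equal to it.
    highCrossing : ∀ {i u v k₁ k₂} → c u ≡ i → c v ≡ i → Walk G⁻ u x k₁ → Walk G⁻ y v k₂ →
                   suc (k₁ + k₂) ≤ s S i → u ≡ nearestVertex i ⊎ v ≡ nearestVertex i
    highCrossing {i} {u} {v} {k₁} {k₂} cu≡i cv≡i wu wv l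
      with nearestVertex i | nearestVertex-isNearest cu≡i (inj₁ wu)
    ... | r | cr≡i , p , inj₁ r⇝x , minimal =
      inj₁ (≡-sym (sameColour-close⇒≡ cr≡i cu≡i (r⇝x ++ʷ reverseʷ wu) (begin
        p + k₁  ≤⟨ ℕ.+-monoˡ-≤ k₁ (minimal cv≡i (inj₂ (reverseʷ wv))) ⟩
        k₂ + k₁ ≡⟨ ℕ.+-comm k₂ k₁ ⟩
        k₁ + k₂ ≤⟨ ℕ.<⇒≤ l ⟩
        s S i   ∎)))
      where open ℕ.≤-Reasoning
    ... | r | cr≡i , p , inj₂ r⇝y , minimal =
      inj₂ (≡-sym (sameColour-close⇒≡ cr≡i cv≡i (r⇝y ++ʷ wv) (begin
        p + k₂  ≤⟨ ℕ.+-monoˡ-≤ k₂ (minimal cu≡i (inj₁ wu)) ⟩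
        k₁ + k₂ ≤⟨ ℕ.<⇒≤ l ⟩
        s S i   ∎)))
      where open ℕ.≤-Reasoning

    representative : ℕ → Fin (n G)
    representative (suc (suc j)) = nearestVertex (suc (suc (suc j)))
    representative _             = lowRepresentative

    IsRepresentative : Fin (n G) → Set
    IsRepresentative v = v ≡ representative (freshIndex (c v))

    crossingᵢ : ∀ {i u v k₁ k₂} → c u ≡ i → c v ≡ i → Walk G⁻ u x k₁ → Walk G⁻ y v k₂ →
                suc (k₁ + k₂) ≤ s S i →
                u ≡ representative (freshIndex i) ⊎ v ≡ representative (freshIndex i)
    crossingᵢ {0}                 = lowCrossing z≤n
    crossingᵢ {1}                 = lowCrossing (s≤s z≤n)
    crossingᵢ {2}                 = lowCrossing (s≤s (s≤s z≤n))
    crossingᵢ {suc (suc (suc _))} = highCrossing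

    crossing : ∀ {u v k₁ k₂} → c u ≡ c v → Walk G⁻ u x k₁ → Walk G⁻ y v k₂ →
               suc (k₁ + k₂) ≤ s S (c u) → IsRepresentative u ⊎ IsRepresentative v
    crossing {v = v} cu≡cv wu wv l = Sum.map₂ (subst (λ j → v ≡ representative (freshIndex j)) cu≡cv)
      (crossingᵢ refl (≡-sym cu≡cv) wu wv l)

    conflicts-meet-representatives : ∀ {u v} → u ≢ v → c u ≡ c v →
      ¬ IsRepresentative u → ¬ IsRepresentative v → DistGt G u v (s S (c u))
    conflicts-meet-representatives {u} {v} u≢v cu≡cv ¬Ru ¬Rv k k≤sᵢ w with walk-split w
    ... | inj₁ (k′ , k′≤k , w⁻) = far u v u≢v cu≡cv k′ (ℕ.≤-trans k′≤k k≤sᵢ) w⁻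
    ... | inj₂ (inj₁ (_ , _ , wu , wv , l)) = Sum.[ ¬Ru , ¬Rv ] (crossing cu≡cv wu wv (ℕ.≤-trans l k≤sᵢ))
    ... | inj₂ (inj₂ (k₁ , k₂ , wu , wv , l)) = Sum.[ ¬Rv , ¬Ru ]
      (crossing (≡-sym cu≡cv) (reverseʷ wv) (reverseʷ wu) (begin
        suc (k₂ + k₁) ≡⟨ cong suc (ℕ.+-comm k₂ k₁) ⟩
        suc (k₁ + k₂) ≤⟨ ℕ.≤-trans l k≤sᵢ ⟩
        s S (c u)     ≡⟨ cong (s S) cu≡cv ⟩
        s S (c v)     ∎))
      where open ℕ.≤-Reasoning

    colouring : 2 ≤ a → HasPackingColoring S G (a + (a ∸ 1))
    colouring 2≤a = freshRecolouring S c bounded (λ v → freshIndex (c v))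
      (λ v → freshIndex-bounded 2≤a (proj₂ (bounded v)))
      (λ v → v ≟ representative (freshIndex (c v)))
      (λ Ru Rv same → trans Ru (trans (cong representative same) (≡-sym Rv)))
      conflicts-meet-representatives

m≤n+[n∸1]⇒m+1≤2*n : ∀ {m n} → 1 ≤ n → m ≤ n + (n ∸ 1) → m + 1 ≤ 2 * n
m≤n+[n∸1]⇒m+1≤2*n {m} {n} 1≤n m≤ = begin
  m + 1           ≤⟨ ℕ.+-monoˡ-≤ 1 m≤ ⟩
  n + (n ∸ 1) + 1 ≡⟨ ℕ.+-assoc n (n ∸ 1) 1 ⟩
  n + (n ∸ 1 + 1) ≡⟨ cong (n +_) (ℕ.m∸n+n≡m 1≤n) ⟩
  n + n           ≡⟨ cong (n +_) (≡-sym (ℕ.+-identityʳ n)) ⟩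
  2 * n           ∎
  where open ℕ.≤-Reasoning

-- The bound is decidable, so connectivity may be assumed decidable.
proposition5p4 : (S : PackingSeq) → s S 2 ≤ 2 →
    (G : Graph) → (x y : Fin (n G)) → IsCutEdge G x y →
    (a b : ℕ) → ChiS S (deleteEdge G x y) a → ChiS S G b →
    2 ≤ a → b + 1 ≤ 2 * a
proposition5p4 S s₂≤2 G x y cutEdge a b ((c , valid) , _) (_ , minimal) 2≤a =
  decidable-stable (b + 1 ≤? 2 * a) λ ¬bound →
    ¬¬-decidableConnected G λ connected? →
    ¬¬-decidableConnected G⁻ λ connected⁻? →
    ¬bound (m≤n+[n∸1]⇒m+1≤2*n (ℕ.≤-trans (s≤s z≤n) 2≤a) (minimal _ (recolour connected? connected⁻?)))
  where
  open EdgeDeletion G x y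
  open Construction S s₂≤2 G x y
  recolour : Decidable (Connected G) → Decidable (Connected G⁻) → HasPackingColoring S G (a + (a ∸ 1))
  recolour connected? connected⁻?
    with alignLow 2≤a (cutEdge⇒disconnected connected? connected⁻? cutEdge) connected⁻? valid
  ... | _ , valid′ , aligned = Recolouring.colouring connected⁻? valid′ aligned 2≤a
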